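{- Let $\mathcal{C}$ be a permutation class that is sum closed and rc-invariant. Then $$\liminf_{n\to\infty}|\mathcal{C}^{rc}_{2n}|^{1/n}\;\ge\;\lim_{n\to\infty}|\mathcal{C}_n|^{1/n}.$$
   Context: A permutation of size $n$ is a bijection of $[n]$; $\pi$ contains $\sigma$ if some subsequence of $\pi$ has the same relative order as $\sigma$; a permutation class is a set of permutations closed downward under containment; $\mathcal{C}_n$ is the set of size-$n$ elements of $\mathcal{C}$. For $\pi$ of size $n$, $\mathrm{rc}(\pi)(i)=n+1-\pi(n+1-i)$; $\pi$ is centrosymmetric if $\mathrm{rc}(\pi)=\pi$; $\mathcal{C}^{rc}_n$ is the set of centrosymmetric elements of $\mathcal{C}_n$; $\mathcal{C}$ is rc-invariant if $\mathrm{rc}(\mathcal{C})=\mathcal{C}$. For $\sigma$ of size $a$ and $\tau$ of size $b$, the sum $\sigma\oplus\tau$ is the permutation of size $a+b$ with $(\sigma\oplus\tau)(i)=\sigma(i)$ for $i\le a$ and $(\sigma\oplus\tau)(i)=a+\tau(i-a)$ for $i>a$. $\mathcal{C}$ is sum closed if $\sigma,\tau\in\mathcal{C}$ implies $\sigma\oplus\tau\in\mathcal{C}$. (For sum closed classes the limit $\lim_n|\mathcal{C}_n|^{1/n}$ is known to exist.) -}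

module Defs where

open import Data.Nat using (ℕ; _+_; _*_; _^_; _≤_; _<_)
open import Data.Fin using (Fin; _↑ˡ_; _↑ʳ_; opposite) renaming (_<_ to _<ᶠ_)
open import Data.Vec using (Vec; lookup; tabulate; map; _++_)
open import Data.Product using (Σ; _×_; ∃-syntax)
open import Relation.Binary.PropositionalEquality using (_≡_)
open import Function.Bundles using (_⇔_)

-- A permutation of size n in one-line notation (0-indexed): a vector
-- v : Vec (Fin n) n whose entry map i ↦ v[i] is injective (hence bijective).
IsPerm : ∀ {n} → Vec (Fin n) n → Set
IsPerm {n} v = (i j : Fin n) → lookup v i ≡ lookup v j → i ≡ j

Contains : ∀ {n k} → Vec (Fin n) n → Vec (Fin k) k → Set
Contains {n} {k} π σ =
  Σ (Fin k → Fin n) λ e →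
    ((i j : Fin k) → i <ᶠ j → e i <ᶠ e j) ×
    ((i j : Fin k) → (lookup σ i <ᶠ lookup σ j) ⇔ (lookup π (e i) <ᶠ lookup π (e j)))

PermSet : Set₁
PermSet = ∀ {n} → Vec (Fin n) n → Set

IsPermClass : PermSet → Set
IsPermClass C =
  (∀ {n} (π : Vec (Fin n) n) → C π → IsPerm π) ×
  (∀ {n k} (π : Vec (Fin n) n) (σ : Vec (Fin k) k) → C π → IsPerm σ → Contains π σ → C σ)

_⊕_ : ∀ {a b} → Vec (Fin a) a → Vec (Fin b) b → Vec (Fin (a + b)) (a + b)
_⊕_ {a} {b} σ τ = map (_↑ˡ b) σ ++ map (a ↑ʳ_) τ

-- Reverse-complement: rc(π)(i) = n+1-π(n+1-i); 0-indexed: opposite (π (opposite i)).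
rc : ∀ {n} → Vec (Fin n) n → Vec (Fin n) n
rc π = tabulate λ i → opposite (lookup π (opposite i))

Centrosymmetric : ∀ {n} → Vec (Fin n) n → Set
Centrosymmetric π = rc π ≡ π

SumClosed : PermSet → Set
SumClosed C = ∀ {a b} (σ : Vec (Fin a) a) (τ : Vec (Fin b) b) → C σ → C τ → C (σ ⊕ τ)

-- rc(C) = C  (as C ⊆ rc(C) and rc(C) ⊆ C, using that rc is an involution).
RcInvariant : PermSet → Set
RcInvariant C = ∀ {n} (π : Vec (Fin n) n) → (C (rc π) ⇔ C π)

AtLeast : (n : ℕ) → (Vec (Fin n) n → Set) → ℕ → Set
AtLeast n P m =
  Σ (Fin m → Vec (Fin n) n) λ f →
    ((i j : Fin m) → f i ≡ f j → i ≡ j) × ((i : Fin m) → P (f i))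

Cn : PermSet → (n : ℕ) → Vec (Fin n) n → Set
Cn C n π = C π

Crc : PermSet → (n : ℕ) → Vec (Fin n) n → Set
Crc C n π = C π × Centrosymmetric π

module Submission where

-- The map π ↦ π ⊕ rc(π) sends C_n injectively into C^rc_{2n}: the image lies in C by
-- sum closure and rc-invariance, it is centrosymmetric because rc(σ ⊕ τ) = rc(τ) ⊕ rc(σ)
-- and rc is an involution, and π is recovered as its first half. Hence
-- |C^rc_{2n}| ≥ |C_n|, and a lower bound (c/d)^n ≤ |C_n| gives (a/b)^n < |C^rc_{2n}|
-- whenever a/b < c/d and n ≥ 1.

open import Defs
open import Data.Nat using (ℕ; zero; suc; _+_; _*_; _^_; _∸_; _≤_; _<_; s≤s; NonZero)
open import Data.Nat.Properties
  using (*-commutativeSemigroup; *-assoc; *-comm; *-cancelʳ-<; *-monoˡ-≤; ^-monoˡ-<;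
         +-∸-assoc; m≤n⇒m≤1+n; module ≤-Reasoning)
open import Data.Fin using (Fin; _↑ˡ_; _↑ʳ_; opposite; toℕ; splitAt)
open import Data.Fin.Properties
  using (toℕ-injective; toℕ-↑ˡ; toℕ-↑ʳ; toℕ<n; opposite-prop; opposite-involutive;
         ↑ˡ-injective; join-splitAt)
open import Data.Vec using (Vec; lookup; map; _++_)
open import Data.Vec.Properties
  using (tabulate∘lookup; tabulate-cong; lookup∘tabulate; lookup-map; lookup-++ˡ; lookup-++ʳ)
open import Data.Product using (_×_; ∃-syntax; _,_)
open import Data.Sum using (inj₁; inj₂)
open import Relation.Binary.PropositionalEquality
open import Function.Bundles using (Equivalence)
open import Algebra.Properties.CommutativeSemigroup *-commutativeSemigroup using (interchange)

lookup-extensionality : ∀ {A : Set} {n} (u v : Vec A n) →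
  (∀ i → lookup u i ≡ lookup v i) → u ≡ v
lookup-extensionality u v eq =
  trans (sym (tabulate∘lookup u)) (trans (tabulate-cong eq) (tabulate∘lookup v))

data Split (m n : ℕ) : Fin (m + n) → Set where
  left  : (j : Fin m) → Split m n (j ↑ˡ n)
  right : (k : Fin n) → Split m n (m ↑ʳ k)

split : ∀ m n (i : Fin (m + n)) → Split m n i
split m n i with splitAt m i | join-splitAt m n i
... | inj₁ j | refl = left j
... | inj₂ k | refl = right k

opposite-↑ˡ : ∀ n (j : Fin n) → opposite (j ↑ˡ n) ≡ n ↑ʳ opposite j
opposite-↑ˡ n j = toℕ-injective (begin
  toℕ (opposite (j ↑ˡ n))   ≡⟨ opposite-prop (j ↑ˡ n) ⟩
  n + n ∸ suc (toℕ (j ↑ˡ n)) ≡⟨ cong (λ x → n + n ∸ suc x) (toℕ-↑ˡ j n) ⟩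
  n + n ∸ suc (toℕ j)        ≡⟨ +-∸-assoc n (toℕ<n j) ⟩
  n + (n ∸ suc (toℕ j))      ≡⟨ cong (n +_) (opposite-prop j) ⟨
  n + toℕ (opposite j)       ≡⟨ toℕ-↑ʳ n (opposite j) ⟨
  toℕ (n ↑ʳ opposite j)      ∎)
  where open ≡-Reasoning

opposite-↑ʳ : ∀ n (k : Fin n) → opposite (n ↑ʳ k) ≡ opposite k ↑ˡ n
opposite-↑ʳ n k = begin
  opposite (n ↑ʳ k)                       ≡⟨ cong (λ x → opposite (n ↑ʳ x)) (opposite-involutive k) ⟨
  opposite (n ↑ʳ opposite (opposite k))   ≡⟨ cong opposite (opposite-↑ˡ n (opposite k)) ⟨
  opposite (opposite (opposite k ↑ˡ n))   ≡⟨ opposite-involutive _ ⟩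
  opposite k ↑ˡ n                         ∎
  where open ≡-Reasoning

lookup-rc : ∀ {n} (π : Vec (Fin n) n) i → lookup (rc π) i ≡ opposite (lookup π (opposite i))
lookup-rc π = lookup∘tabulate _

rc-involutive : ∀ {n} (π : Vec (Fin n) n) → rc (rc π) ≡ π
rc-involutive π = lookup-extensionality _ _ λ i → begin
  lookup (rc (rc π)) i                              ≡⟨ lookup-rc (rc π) i ⟩
  opposite (lookup (rc π) (opposite i))             ≡⟨ cong opposite (lookup-rc π (opposite i)) ⟩
  opposite (opposite (lookup π (opposite (opposite i)))) ≡⟨ opposite-involutive _ ⟩
  lookup π (opposite (opposite i))                  ≡⟨ cong (lookup π) (opposite-involutive i) ⟩
  lookup π i                                        ∎
  where open ≡-Reasoning

lookup-⊕-↑ˡ : ∀ {m n} (σ : Vec (Fin m) m) (τ : Vec (Fin n) n) j →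
  lookup (σ ⊕ τ) (j ↑ˡ n) ≡ lookup σ j ↑ˡ n
lookup-⊕-↑ˡ {m} {n} σ τ j = trans (lookup-++ˡ (map (_↑ˡ n) σ) (map (m ↑ʳ_) τ) j) (lookup-map j _ σ)

lookup-⊕-↑ʳ : ∀ {m n} (σ : Vec (Fin m) m) (τ : Vec (Fin n) n) k →
  lookup (σ ⊕ τ) (m ↑ʳ k) ≡ m ↑ʳ lookup τ k
lookup-⊕-↑ʳ {m} {n} σ τ k = trans (lookup-++ʳ (map (_↑ˡ n) σ) (map (m ↑ʳ_) τ) k) (lookup-map k _ τ)

rc-⊕ : ∀ {n} (σ τ : Vec (Fin n) n) → rc (σ ⊕ τ) ≡ rc τ ⊕ rc σ
rc-⊕ {n} σ τ = lookup-extensionality _ _ λ i → pointwise (split n n i)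
  where
  open ≡-Reasoning
  pointwise : ∀ {i} → Split n n i → lookup (rc (σ ⊕ τ)) i ≡ lookup (rc τ ⊕ rc σ) i
  pointwise (left j) = begin
    lookup (rc (σ ⊕ τ)) (j ↑ˡ n)                    ≡⟨ lookup-rc (σ ⊕ τ) (j ↑ˡ n) ⟩
    opposite (lookup (σ ⊕ τ) (opposite (j ↑ˡ n)))   ≡⟨ cong (λ x → opposite (lookup (σ ⊕ τ) x)) (opposite-↑ˡ n j) ⟩
    opposite (lookup (σ ⊕ τ) (n ↑ʳ opposite j))     ≡⟨ cong opposite (lookup-⊕-↑ʳ σ τ (opposite j)) ⟩
    opposite (n ↑ʳ lookup τ (opposite j))           ≡⟨ opposite-↑ʳ n _ ⟩
    opposite (lookup τ (opposite j)) ↑ˡ n           ≡⟨ cong (_↑ˡ n) (lookup-rc τ j) ⟨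
    lookup (rc τ) j ↑ˡ n                            ≡⟨ lookup-⊕-↑ˡ (rc τ) (rc σ) j ⟨
    lookup (rc τ ⊕ rc σ) (j ↑ˡ n)                   ∎
  pointwise (right k) = begin
    lookup (rc (σ ⊕ τ)) (n ↑ʳ k)                    ≡⟨ lookup-rc (σ ⊕ τ) (n ↑ʳ k) ⟩
    opposite (lookup (σ ⊕ τ) (opposite (n ↑ʳ k)))   ≡⟨ cong (λ x → opposite (lookup (σ ⊕ τ) x)) (opposite-↑ʳ n k) ⟩
    opposite (lookup (σ ⊕ τ) (opposite k ↑ˡ n))     ≡⟨ cong opposite (lookup-⊕-↑ˡ σ τ (opposite k)) ⟩
    opposite (lookup σ (opposite k) ↑ˡ n)           ≡⟨ opposite-↑ˡ n _ ⟩
    n ↑ʳ opposite (lookup σ (opposite k))           ≡⟨ cong (n ↑ʳ_) (lookup-rc σ k) ⟨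
    n ↑ʳ lookup (rc σ) k                            ≡⟨ lookup-⊕-↑ʳ (rc τ) (rc σ) k ⟨
    lookup (rc τ ⊕ rc σ) (n ↑ʳ k)                   ∎

double : ∀ {n} → Vec (Fin n) n → Vec (Fin (n + n)) (n + n)
double π = π ⊕ rc π

double-centrosymmetric : ∀ {n} (π : Vec (Fin n) n) → Centrosymmetric (double π)
double-centrosymmetric π = trans (rc-⊕ π (rc π)) (cong (_⊕ rc π) (rc-involutive π))

double-injective : ∀ {n} (π π′ : Vec (Fin n) n) → double π ≡ double π′ → π ≡ π′
double-injective {n} π π′ eq = lookup-extensionality π π′ λ j → ↑ˡ-injective n _ _ (begin
  lookup π j ↑ˡ n                ≡⟨ lookup-⊕-↑ˡ π (rc π) j ⟨
  lookup (double π) (j ↑ˡ n)     ≡⟨ cong (λ v → lookup v (j ↑ˡ n)) eq ⟩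
  lookup (double π′) (j ↑ˡ n)    ≡⟨ lookup-⊕-↑ˡ π′ (rc π′) j ⟩
  lookup π′ j ↑ˡ n               ∎)
  where open ≡-Reasoning

double-∈-Crc : ∀ (C : PermSet) → SumClosed C → RcInvariant C →
  ∀ {n} (π : Vec (Fin n) n) → C π → Crc C (n + n) (double π)
double-∈-Crc C sumClosed rcInvariant π π∈C =
  sumClosed π (rc π) π∈C (Equivalence.from (rcInvariant π) π∈C) , double-centrosymmetric π

AtLeast-map : ∀ {n n′} {P : Vec (Fin n) n → Set} {Q : Vec (Fin n′) n′ → Set} {m}
  (g : Vec (Fin n) n → Vec (Fin n′) n′) →
  (∀ u v → g u ≡ g v → u ≡ v) → (∀ u → P u → Q (g u)) →
  AtLeast n P m → AtLeast n′ Q m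
AtLeast-map g g-injective g-preserves (f , f-injective , f∈P) =
  (λ i → g (f i)) ,
  (λ i j eq → f-injective i j (g-injective (f i) (f j) eq)) ,
  (λ i → g-preserves (f i) (f∈P i))

^-distrib-* : ∀ x y n → (x * y) ^ n ≡ x ^ n * y ^ n
^-distrib-* x y zero    = refl
^-distrib-* x y (suc n) = begin
  x * y * (x * y) ^ n         ≡⟨ cong (x * y *_) (^-distrib-* x y n) ⟩
  x * y * (x ^ n * y ^ n)     ≡⟨ interchange x y (x ^ n) (y ^ n) ⟩
  x * x ^ n * (y * y ^ n)     ∎
  where open ≡-Reasoning

a*d<c*b⇒a^n<b^n*m : ∀ a b c d {m} n .{{_ : NonZero n}} →
  a * d < c * b → c ^ n ≤ d ^ n * m → a ^ n < b ^ n * m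
a*d<c*b⇒a^n<b^n*m a b c d {m} n ad<cb cⁿ≤dⁿm = *-cancelʳ-< (d ^ n) (a ^ n) (b ^ n * m) (begin-strict
  a ^ n * d ^ n       ≡⟨ ^-distrib-* a d n ⟨
  (a * d) ^ n         <⟨ ^-monoˡ-< n ad<cb ⟩
  (c * b) ^ n         ≡⟨ ^-distrib-* c b n ⟩
  c ^ n * b ^ n       ≤⟨ *-monoˡ-≤ (b ^ n) cⁿ≤dⁿm ⟩
  d ^ n * m * b ^ n   ≡⟨ *-comm (d ^ n * m) (b ^ n) ⟩
  b ^ n * (d ^ n * m) ≡⟨ cong (b ^ n *_) (*-comm (d ^ n) m) ⟩
  b ^ n * (m * d ^ n) ≡⟨ *-assoc (b ^ n) m (d ^ n) ⟨
  b ^ n * m * d ^ n   ∎)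
  where open ≤-Reasoning

theorem1p3 : (C : PermSet) → IsPermClass C → SumClosed C → RcInvariant C →
    (a b c d : ℕ) → 0 < b → 0 < d → a * d < c * b →
    (∃[ N ] ((n : ℕ) → N ≤ n → ∃[ m ] (c ^ n ≤ d ^ n * m × AtLeast n (Cn C n) m))) →
    ∃[ N ] ((n : ℕ) → N ≤ n → ∃[ m ] (a ^ n < b ^ n * m × AtLeast (n + n) (Crc C (n + n)) m))
theorem1p3 C _ sumClosed rcInvariant a b c d _ _ ad<cb (N , Cn-large) = suc N , Crc-large
  where
  Crc-large : (n : ℕ) → suc N ≤ n →
    ∃[ m ] (a ^ n < b ^ n * m × AtLeast (n + n) (Crc C (n + n)) m)
  Crc-large (suc k) (s≤s N≤k) with Cn-large (suc k) (m≤n⇒m≤1+n N≤k)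
  ... | m , cⁿ≤dⁿm , Cn-atLeast =
    m , a*d<c*b⇒a^n<b^n*m a b c d (suc k) ad<cb cⁿ≤dⁿm ,
    AtLeast-map {Q = Crc C (suc k + suc k)} double double-injective (double-∈-Crc C sumClosed rcInvariant) Cn-atLeast
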